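{- Let $r\geq 2$ be even and let $A$ be a cubical $r$-matrix of order $n$ which has an odd transversal. Then $A$ is odd-colorable.
   Context: A cubical $r$-matrix of order $n$ is a function $A:[n]^r\to\mathbb{C}$, with entries $a_{i_1,\ldots,i_r}$. For even $r$, $A$ is odd-colorable if there is a map $\varphi:[n]\to[r]$ such that whenever $a_{i_1,\ldots,i_r}\neq 0$, we have $\varphi(i_1)+\cdots+\varphi(i_r)\equiv r/2 \pmod r$. A set $X\subset[n]$ is an odd transversal of $A$ if whenever $a_{i_1,\ldots,i_r}\neq0$, we have $I_X(i_1)+\cdots+I_X(i_r)\equiv 1\pmod 2$, where $I_X$ is the indicator function of $X$. -}

module Defs where

open import Data.Nat using (ℕ; zero; suc; _+_; _%_; _/_; _≤_; NonZero)
open import Data.Fin using (Fin)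
open import Data.Fin.Subset using (Subset; _∈_)
open import Data.Bool using (true; false)
open import Data.Vec using (lookup)
open import Data.Product using (∃; _×_)
open import Relation.Binary.PropositionalEquality using (_≡_; _≢_)

Σᵣ : {r : ℕ} → (Fin r → ℕ) → ℕ
Σᵣ {zero} f = 0
Σᵣ {suc r} f = f Fin.zero + Σᵣ {r} (λ k → f (Fin.suc k))

CubicalMatrix : ∀ {c} → Set c → ℕ → ℕ → Set c
CubicalMatrix C r n = (Fin r → Fin n) → C

indicator : {n : ℕ} → Subset n → Fin n → ℕ
indicator X i with lookup X i
... | true = 1
... | false = 0

IsOddTransversal : ∀ {c} {C : Set c} (0C : C) {r n : ℕ} →
                   CubicalMatrix C r n → Subset n → Set c
IsOddTransversal 0C A X =
  ∀ (i : Fin _ → Fin _) → A i ≢ 0C → Σᵣ (λ k → indicator X (i k)) % 2 ≡ 1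

HasOddTransversal : ∀ {c} {C : Set c} (0C : C) {r n : ℕ} →
                    CubicalMatrix C r n → Set c
HasOddTransversal 0C {n = n} A = ∃ λ (X : Subset n) → IsOddTransversal 0C A X

IsColoring : (r n : ℕ) → (Fin n → ℕ) → Set
IsColoring r n φ = ∀ i → 1 ≤ φ i × φ i ≤ r

IsOddColorable : ∀ {c} {C : Set c} (0C : C) {r n : ℕ} .{{_ : NonZero r}} →
                 CubicalMatrix C r n → Set c
IsOddColorable 0C {r} {n} A =
  ∃ λ (φ : Fin n → ℕ) → IsColoring r n φ ×
    (∀ (i : Fin r → Fin n) → A i ≢ 0C → Σᵣ (λ k → φ (i k)) % r ≡ (r / 2) % r)

-- Colour i ∈ X with m = r/2 and i ∉ X with 2m, i.e. φ(i) = (2 − I_X(i))·m. For a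
-- nonzero entry, Σ (2 − I_X(iₖ)) = 2r − Σ I_X(iₖ) is odd, and an odd multiple of m
-- is congruent to m modulo 2m.
module Submission where

open import Defs
open import Data.Nat using (ℕ; zero; suc; _+_; _∸_; _≤_; _*_; _%_; _/_; NonZero; >-nonZero⁻¹; z≤n; s≤s)
open import Data.Nat.Properties
open import Data.Nat.DivMod
open import Algebra.Properties.CommutativeSemigroup +-commutativeSemigroup using (interchange)
open import Data.Fin using (Fin)
open import Data.Fin.Subset using (Subset)
open import Data.Vec using (lookup)
open import Data.Bool using (true; false)
open import Data.Product using (∃; _,_)
open import Data.Empty using (⊥-elim)
open import Relation.Binary.PropositionalEquality
open import Level using (Level)

Σᵣ-+ : ∀ {r} (f g : Fin r → ℕ) → Σᵣ (λ k → f k + g k) ≡ Σᵣ f + Σᵣ g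
Σᵣ-+ {zero}  f g = refl
Σᵣ-+ {suc r} f g =
  trans (cong (f Fin.zero + g Fin.zero +_) (Σᵣ-+ (λ k → f (Fin.suc k)) (λ k → g (Fin.suc k))))
        (interchange (f Fin.zero) (g Fin.zero) _ _)

Σᵣ-const : ∀ {r} (f : Fin r → ℕ) c → (∀ k → f k ≡ c) → Σᵣ f ≡ r * c
Σᵣ-const {zero}  f c f≡c = refl
Σᵣ-const {suc r} f c f≡c =
  cong₂ _+_ (f≡c Fin.zero) (Σᵣ-const (λ k → f (Fin.suc k)) c (λ k → f≡c (Fin.suc k)))

Σᵣ-*ʳ : ∀ {r} (f : Fin r → ℕ) m → Σᵣ (λ k → f k * m) ≡ Σᵣ f * m
Σᵣ-*ʳ {zero}  f m = refl
Σᵣ-*ʳ {suc r} f m =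
  trans (cong (f Fin.zero * m +_) (Σᵣ-*ʳ (λ k → f (Fin.suc k)) m))
        (sym (*-distribʳ-+ m (f Fin.zero) _))

indicator≤1 : ∀ {n} (X : Subset n) i → indicator X i ≤ 1
indicator≤1 X i with lookup X i
... | true  = ≤-refl
... | false = z≤n

odd-complement : ∀ a b k → a + b ≡ k * 2 → b % 2 ≡ 1 → a % 2 ≡ 1
odd-complement a b k a+b≡2k b-odd with a % 2 | m%n<n a 2 | %-distribˡ-+ a b 2
... | 1           | _            | _  = refl
... | suc (suc _) | s≤s (s≤s ()) | _
... | 0           | _            | eq = ⊥-elim (0≢1+n (begin
  0              ≡⟨ m*n%n≡0 k 2 ⟨
  (k * 2) % 2    ≡⟨ cong (_% 2) a+b≡2k ⟨
  (a + b) % 2    ≡⟨ eq ⟩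
  (b % 2) % 2    ≡⟨ cong (_% 2) b-odd ⟩
  1              ∎))
  where open ≡-Reasoning

instance
  2*-nonZero : ∀ {m} .{{_ : NonZero m}} → NonZero (2 * m)
  2*-nonZero {m} = m*n≢0 2 m

odd*m%2m≡m : ∀ t m .{{_ : NonZero m}} → t % 2 ≡ 1 → (t * m) % (2 * m) ≡ m
odd*m%2m≡m t m t-odd = begin
  (t * m) % (2 * m) ≡⟨ m%n*o≡m*o%[n*o] t 2 m ⟨
  t % 2 * m         ≡⟨ cong (_* m) t-odd ⟩
  1 * m             ≡⟨ *-identityˡ m ⟩
  m                 ∎
  where open ≡-Reasoning

halfShiftColoring : ∀ {n} → ℕ → Subset n → Fin n → ℕ
halfShiftColoring m X i = (2 ∸ indicator X i) * m

halfShiftColoring-isColoring : ∀ {n} m .{{_ : NonZero m}} (X : Subset n) →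
                               IsColoring (2 * m) n (halfShiftColoring m X)
halfShiftColoring-isColoring m X i =
  *-mono-≤ (∸-monoʳ-≤ 2 (indicator≤1 X i)) (>-nonZero⁻¹ m) ,
  *-monoˡ-≤ m (m∸n≤m 2 (indicator X i))

halfShiftColoring-Σ : ∀ {r n} m .{{_ : NonZero m}} (X : Subset n) (i : Fin r → Fin n) →
                      Σᵣ (λ k → indicator X (i k)) % 2 ≡ 1 →
                      Σᵣ (λ k → halfShiftColoring m X (i k)) % (2 * m) ≡ m
halfShiftColoring-Σ {r} m X i S-odd = begin
  Σᵣ (λ k → (2 ∸ I k) * m) % (2 * m) ≡⟨ cong (_% (2 * m)) (Σᵣ-*ʳ (λ k → 2 ∸ I k) m) ⟩
  (T * m) % (2 * m)                  ≡⟨ odd*m%2m≡m T m (odd-complement T S r T+S≡2r S-odd) ⟩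
  m                                  ∎
  where
  open ≡-Reasoning
  I : Fin r → ℕ
  I k = indicator X (i k)
  T S : ℕ
  T = Σᵣ (λ k → 2 ∸ I k)
  S = Σᵣ I
  T+S≡2r : T + S ≡ r * 2
  T+S≡2r = begin
    T + S                        ≡⟨ Σᵣ-+ (λ k → 2 ∸ I k) I ⟨
    Σᵣ (λ k → (2 ∸ I k) + I k)   ≡⟨ Σᵣ-const _ 2 (λ k → m∸n+n≡m (≤-trans (indicator≤1 X (i k)) (n≤1+n 1))) ⟩
    r * 2                        ∎

proposition4 : ∀ {c : Level} (C : Set c) (0C : C) (r n : ℕ) .{{_ : NonZero r}} →
                 2 ≤ r → (∃ λ m → r ≡ 2 * m) →
                 (A : CubicalMatrix C r n) →
                 HasOddTransversal 0C A → IsOddColorable 0C A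
-- The case m = 0 is ruled out by NonZero r, which also makes 2 ≤ r redundant.
proposition4 C 0C .(2 * m) n _ (m@(suc _) , refl) A (X , X-odd) =
  halfShiftColoring m X ,
  halfShiftColoring-isColoring m X ,
  λ i Aᵢ≢0 → begin
    Σᵣ (λ k → halfShiftColoring m X (i k)) % (2 * m) ≡⟨ halfShiftColoring-Σ m X i (X-odd i Aᵢ≢0) ⟩
    m                                                 ≡⟨ odd*m%2m≡m 1 m refl ⟨
    (1 * m) % (2 * m)                                 ≡⟨ cong (_% (2 * m)) (*-identityˡ m) ⟩
    m % (2 * m)                                       ≡⟨ cong (_% (2 * m)) (m*n/n≡m m 2) ⟨
    (m * 2 / 2) % (2 * m)                             ≡⟨ cong (λ x → x / 2 % (2 * m)) (*-comm m 2) ⟩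
    (2 * m / 2) % (2 * m)                             ∎
  where open ≡-Reasoning
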